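{- Let $G,H$ be $\mathbf{e}$-free edge-labelled graphs and $\mathcal{R}\subseteq X_G\times X_H$. Let $T_1,\dots,T_{p-1},T_p,T_{p+1}$ be distinct vertices of a contraction $H'$ of $H$, $T_0=T_p\uplus T_{p+1}$, $\mathbb{T}=(T_1,\dots,T_{p-1})$, and let $S_0,S_1,\dots,S_{p-1}$ be pairwise disjoint subsets of $V_G$, $\mathbb{S}=(S_1,\dots,S_{p-1})$. Then $$\mathcal{R}^{\mathbb{S},S_0}_{\mathbb{T},T_0}=\biguplus_{\substack{S_p\uplus S_{p+1}=S_0\\(\mathbb{S},S_p,S_{p+1})\preceq_{\mathcal{R}}(\mathbb{T},T_p,T_{p+1})}}\mathcal{R}^{\mathbb{S},S_p,S_{p+1}}_{\mathbb{T},T_p,T_{p+1}},$$ the union ranging over pairs $(S_p,S_{p+1})$ of disjoint subsets with union $S_0$.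
   Context: Edge-labelled graph: $G=(V_G,l_G,X_G)$, finite $V_G,X_G$, $l_G:V_G^2\to X_G$; $\mathbf{e}$-free if the special symbol $\mathbf{e}\notin X_G$; $G[S]=(S,l_G|_{S^2},X_G)$. $\mathcal{R}$-morphism: $(l_G(u,v),l_H(f(u),f(v)))\in\mathcal{R}$ for all $u,v$. A contraction $H'$ of $H$ relative to a partition of $V_H$ into nonempty parts has these parts as vertices and label $x$ on $(T,T')$ if $l_H$ is constantly $x$ on $T\times T'$, else $\mathbf{e}$. For $\mathbb{S}=(S_1,\dots,S_r)$ pairwise disjoint subsets of $V_G$ and $\mathbb{T}=(T_1,\dots,T_r)$ pairwise disjoint subsets of $V_H$, $\mathcal{R}^{\mathbb{S}}_{\mathbb{T}}$ is the set of $\mathcal{R}$-morphisms $f$ from $G[S_1\uplus\dots\uplus S_r]$ to $H[T_1\uplus\dots\uplus T_r]$ with $f(S_i)\subseteq T_i$ for all $i$; commas denote concatenation of tuples. $\mathbb{S}\preceq_{\mathcal{R}}\mathbb{T}$ (for $T_i$ distinct vertices of $H'$): for all $i,i'$, if $l_{H'}(T_i,T_{i'})\neq\mathbf{e}$ then $(l_G(u,v),l_{H'}(T_i,T_{i'}))\in\mathcal{R}$ for all $(u,v)\in S_i\times S_{i'}$. -}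

module Defs where

open import Data.Nat using (ℕ; suc; _+_)
open import Data.Fin using (Fin)
open import Data.Fin.Subset using (Subset; _∈_; _∩_; _∪_; ⊥)
open import Data.Maybe using (Maybe; just; nothing)
open import Data.Product using (Σ; ∃; _×_; _,_)
open import Data.Sum using (_⊎_)
open import Relation.Nullary using (¬_)
open import Relation.Binary.PropositionalEquality using (_≡_; _≢_)
open import Data.Vec.Functional using (Vector; _++_; _∷_; [])

-- An e-free edge-labelled graph: vertex set Fin n, finite label set Fin k
-- (the special symbol e is NOT an element of Fin k; it is modelled by
-- `nothing` in `Maybe (Fin k)` wherever it can occur, i.e. in contractions).
record EGraph : Set where
  field
    n   : ℕ
    k   : ℕ
    lab : Fin n → Fin n → Fin k
open EGraph public

Disjoint : ∀ {n} → Subset n → Subset n → Set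
Disjoint A B = A ∩ B ≡ ⊥

record Partition (m : ℕ) : Set where
  field
    q        : ℕ
    part     : Fin m → Fin q
    nonempty : ∀ (a : Fin q) → ∃ λ u → part u ≡ a
open Partition public

-- The vertex (part) a of the contraction, as a set of vertices of H.
Block : ∀ {m} (P : Partition m) → Fin (q P) → Fin m → Set
Block P a u = part P u ≡ a

ConstOn : (H : EGraph) (P : Partition (n H)) → Fin (q P) → Fin (q P) → Fin (k H) → Set
ConstOn H P a b x = ∀ u v → Block P a u → Block P b v → lab H u v ≡ x

-- Label of the contraction H' (relative to P) on (a , b): `just x` if l_H is
-- constantly x on a × b, otherwise `nothing` (= the symbol e).
ContrLabel : (H : EGraph) (P : Partition (n H)) → Fin (q P) → Fin (q P) → Maybe (Fin (k H)) → Set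
ContrLabel H P a b (just x) = ConstOn H P a b x
ContrLabel H P a b nothing  = ¬ (∃ λ x → ConstOn H P a b x)

Rel : EGraph → EGraph → Set₁
Rel G H = Fin (k G) → Fin (k H) → Set

InUnion : ∀ {n r} → Vector (Subset n) r → Fin n → Set
InUnion S u = ∃ λ i → u ∈ S i

-- f ∈ R^S_T : f is an R-morphism from G[S_1 ⊎ … ⊎ S_r] to H[T_1 ⊎ … ⊎ T_r]
-- with f(S_i) ⊆ T_i. Morphisms are represented by total maps V_G → V_H, of
-- which only the restriction to the domain S_1 ⊎ … ⊎ S_r matters.
IsRMor : (G H : EGraph) (R : Rel G H) {r : ℕ}
         → Vector (Subset (n G)) r → Vector (Fin (n H) → Set) r
         → (Fin (n G) → Fin (n H)) → Set
IsRMor G H R S T f =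
  (∀ i u → u ∈ S i → T i (f u)) ×
  (∀ u v → InUnion S u → InUnion S v → R (lab G u v) (lab H (f u) (f v)))

Prec : (G H : EGraph) (R : Rel G H) (P : Partition (n H)) {r : ℕ}
       → Vector (Subset (n G)) r → Vector (Fin (q P)) r → Set
Prec G H R P S t =
  ∀ i i' x → ContrLabel H P (t i) (t i') (just x) →
  ∀ u v → u ∈ S i → v ∈ S i' → R (lab G u v) x

PairwiseDisjoint : ∀ {n r} → Vector (Subset n) r → Set
PairwiseDisjoint S = ∀ i j → i ≢ j → Disjoint (S i) (S j)

Distinct : ∀ {A : Set} {r} → Vector A r → Set
Distinct t = ∀ i j → t i ≡ t j → i ≡ j

BlockUnion : ∀ {m} (P : Partition m) → Fin (q P) → Fin (q P) → Fin m → Set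
BlockUnion P a b u = Block P a u ⊎ Block P b u

-- Membership of f in the piece of the union indexed by the pair (S_p , S_{p+1}),
-- together with the side conditions of the union's index:
-- S_p ⊎ S_{p+1} = S_0 and (𝕊,S_p,S_{p+1}) ⪯_R (𝕋,T_p,T_{p+1}).
InPiece : (G H : EGraph) (R : Rel G H) (P : Partition (n H)) {r : ℕ}
          (t : Vector (Fin (q P)) r) (tp tp1 : Fin (q P))
          (S : Vector (Subset (n G)) r) (S0 : Subset (n G))
          → Subset (n G) × Subset (n G) → (Fin (n G) → Fin (n H)) → Set
InPiece G H R P t tp tp1 S S0 (Sp , Sp1) f =
  ((Sp ∪ Sp1 ≡ S0) × Disjoint Sp Sp1) ×
  Prec G H R P (S ++ (Sp ∷ (Sp1 ∷ []))) (t ++ (tp ∷ (tp1 ∷ []))) ×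
  IsRMor G H R (S ++ (Sp ∷ (Sp1 ∷ [])))
    ((λ i → Block P (t i)) ++ (Block P tp ∷ (Block P tp1 ∷ []))) f

{-# OPTIONS --safe #-}
-- A morphism f in the left-hand side sends S₀ into T_p ⊎ T_{p+1}, so S₀
-- splits uniquely into the vertices sent to T_p and those sent to T_{p+1}
-- (uniquely because T_p and T_{p+1} are disjoint), and f lies in the piece
-- indexed by that split. The ⪯_R side condition is automatic: if the
-- contraction has a label x ≠ e on (T_i , T_i'), then x is the actual label of
-- every edge of H from T_i to T_i', in particular of the image of each edge
-- of G from S_i to S_i'.
module Submission where

open import Defs
open import Data.Nat using (ℕ)
open import Data.Fin using (Fin)
open import Data.Fin.Subset using (Subset)
open import Data.Product using (Σ; _×_; _,_)
open import Relation.Binary.PropositionalEquality using (_≡_)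
open import Function.Bundles using (_⇔_)
open import Data.Vec.Functional using (Vector; _++_; _∷_; [])

open import Data.Empty using (⊥-elim)
open import Data.Fin using (zero; suc; splitAt; _↑ˡ_; _↑ʳ_; _≟_)
open import Data.Fin.Properties using (splitAt-↑ˡ; splitAt-↑ʳ; ↑ʳ-injective)
open import Data.Fin.Subset using (_∈_; _∉_; _∩_; _∪_; ∁; _⊆_) renaming (⊥ to ∅)
open import Data.Fin.Subset.Properties
  using (⊆-antisym; ⊆-min; x∈p∩q⁻; x∈p∪q⁺; x∈p∪q⁻; p⊆p∪q; q⊆p∪q;
         x∈∁p⇒x∉p; p∪∁p≡⊤; ∩-distribˡ-∪; ∩-identityʳ)
open import Data.Product using (proj₁; proj₂)
open import Data.Sum using (_⊎_; inj₁; inj₂; [_,_]′)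
import Data.Sum as Sum
open import Data.Vec using (tabulate)
open import Data.Vec.Properties using (lookup∘tabulate; []=⇒lookup; lookup⇒[]=)
open import Data.Vec.Functional.Properties using (lookup-++ˡ; lookup-++ʳ)
open import Function using (_∘_)
open import Level using (0ℓ)
open import Function.Bundles using (mk⇔; Equivalence)
open import Relation.Nullary using (does; yes; no; contradiction)
open import Relation.Unary using (Pred; Decidable)
open import Relation.Binary.PropositionalEquality
  using (_≢_; refl; sym; trans; cong; subst; module ≡-Reasoning)

private variable
  a b r r' : ℕ

toSubset : {Q : Pred (Fin a) 0ℓ} → Decidable Q → Subset a
toSubset Q? = tabulate (does ∘ Q?)

module _ {Q : Pred (Fin a) 0ℓ} (Q? : Decidable Q) where

  ∈-toSubset⁺ : ∀ {u} → Q u → u ∈ toSubset Q?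
  ∈-toSubset⁺ {u} q with Q? u in eq
  ... | yes _ = lookup⇒[]= u _ (trans (lookup∘tabulate (does ∘ Q?) u) (cong does eq))
  ... | no ¬q = contradiction q ¬q

  ∈-toSubset⁻ : ∀ {u} → u ∈ toSubset Q? → Q u
  ∈-toSubset⁻ {u} h with Q? u | trans (sym (lookup∘tabulate (does ∘ Q?) u)) ([]=⇒lookup h)
  ... | yes q | _ = q
  ... | no _  | ()

∩-∪-∩∁ : (p q : Subset a) → p ∩ q ∪ p ∩ ∁ q ≡ p
∩-∪-∩∁ p q = begin
  p ∩ q ∪ p ∩ ∁ q  ≡⟨ sym (∩-distribˡ-∪ p q (∁ q)) ⟩
  p ∩ (q ∪ ∁ q)    ≡⟨ cong (p ∩_) (p∪∁p≡⊤ q) ⟩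
  p ∩ _            ≡⟨ ∩-identityʳ p ⟩
  p                ∎
  where open ≡-Reasoning

∩-∩∁-disjoint : (p q : Subset a) → Disjoint (p ∩ q) (p ∩ ∁ q)
∩-∩∁-disjoint p q = ⊆-antisym empty (⊆-min _)
  where
  empty : (p ∩ q) ∩ (p ∩ ∁ q) ⊆ ∅
  empty h with x∈p∩q⁻ _ _ h
  ... | inq , in∁q = ⊥-elim (x∈∁p⇒x∉p (proj₂ (x∈p∩q⁻ p _ in∁q)) (proj₂ (x∈p∩q⁻ p q inq)))

∪-split-unique : {p p' q q' : Subset a} → p ∪ p' ≡ q ∪ q' →
                 (∀ {u} → u ∈ p → u ∉ q') → (∀ {u} → u ∈ q → u ∉ p') →
                 p ≡ q × p' ≡ q'
∪-split-unique eq p∩q'=∅ q∩p'=∅ =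
  ⊆-antisym (left eq p∩q'=∅) (left (sym eq) q∩p'=∅) ,
  ⊆-antisym (right eq q∩p'=∅) (right (sym eq) p∩q'=∅)
  where
  left : ∀ {p p' q q' : Subset _} → p ∪ p' ≡ q ∪ q' → (∀ {u} → u ∈ p → u ∉ q') → p ⊆ q
  left {p} {p'} {q} {q'} eq sep {u} h with x∈p∪q⁻ q q' (subst (u ∈_) eq (p⊆p∪q p' h))
  ... | inj₁ inq  = inq
  ... | inj₂ inq' = contradiction inq' (sep h)
  right : ∀ {p p' q q' : Subset _} → p ∪ p' ≡ q ∪ q' → (∀ {u} → u ∈ q → u ∉ p') → p' ⊆ q'
  right {p} {p'} {q} {q'} eq sep {u} h with x∈p∪q⁻ q q' (subst (u ∈_) eq (q⊆p∪q p p' h))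
  ... | inj₁ inq  = contradiction h (sep inq)
  ... | inj₂ inq' = inq'

last-two-distinct : {A : Set} {t : Vector A r} {x y : A} → Distinct (t ++ (x ∷ (y ∷ []))) → x ≢ y
last-two-distinct {r = r} {t = t} {x} {y} distinct x≡y
  with ↑ʳ-injective r zero (suc zero) (distinct (r ↑ʳ zero) (r ↑ʳ suc zero) lookups-equal)
  where
  lookups-equal : (t ++ (x ∷ (y ∷ []))) (r ↑ʳ zero) ≡ (t ++ (x ∷ (y ∷ []))) (r ↑ʳ suc zero)
  lookups-equal = begin
    (t ++ _) (r ↑ʳ zero)      ≡⟨ lookup-++ʳ t (x ∷ (y ∷ [])) zero ⟩
    x                         ≡⟨ x≡y ⟩
    y                         ≡⟨ lookup-++ʳ t (x ∷ (y ∷ [])) (suc zero) ⟨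
    (t ++ _) (r ↑ʳ suc zero)  ∎
    where open ≡-Reasoning
... | ()

MapsInto : Vector (Subset a) r → Vector (Fin b → Set) r → (Fin a → Fin b) → Set
MapsInto S T f = ∀ i u → u ∈ S i → T i (f u)

PreservesLabels : (G H : EGraph) → Rel G H → Vector (Subset (n G)) r → (Fin (n G) → Fin (n H)) → Set
PreservesLabels G H R S f = ∀ u v → InUnion S u → InUnion S v → R (lab G u v) (lab H (f u) (f v))

module _ {S : Vector (Subset a) r} {S' : Vector (Subset a) r'}
         {T : Vector (Fin b → Set) r} {T' : Vector (Fin b → Set) r'} {f : Fin a → Fin b} where

  MapsInto-++⁺ : MapsInto S T f → MapsInto S' T' f → MapsInto (S ++ S') (T ++ T') f
  MapsInto-++⁺ mS mS' i with splitAt r i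
  ... | inj₁ j = mS j
  ... | inj₂ j = mS' j

  MapsInto-++⁻ : MapsInto (S ++ S') (T ++ T') f → MapsInto S T f × MapsInto S' T' f
  MapsInto-++⁻ m = left , right
    where
    left : MapsInto S T f
    left j with splitAt r (j ↑ˡ r') | splitAt-↑ˡ r j r' | m (j ↑ˡ r')
    ... | _ | refl | mj = mj
    right : MapsInto S' T' f
    right j with splitAt r (r ↑ʳ j) | splitAt-↑ʳ r r' j | m (r ↑ʳ j)
    ... | _ | refl | mj = mj

MapsInto-resp : {S : Vector (Subset a) r} {T T' : Vector (Fin b → Set) r} {f : Fin a → Fin b} →
                (∀ i → T i ≡ T' i) → MapsInto S T f → MapsInto S T' f
MapsInto-resp T≡T' m i u h = subst (λ X → X _) (T≡T' i) (m i u h)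

Block-++ : ∀ {m} (P : Partition m) (t : Vector (Fin (q P)) r) (x y : Fin (q P)) i →
           ((λ i → Block P (t i)) ++ (Block P x ∷ (Block P y ∷ []))) i ≡ Block P ((t ++ (x ∷ (y ∷ []))) i)
Block-++ {r = r} P t x y i with splitAt r i
... | inj₁ _          = refl
... | inj₂ zero       = refl
... | inj₂ (suc zero) = refl

InUnion-++ : {S : Vector (Subset a) r} {S' : Vector (Subset a) r'} {u : Fin a} →
             InUnion (S ++ S') u ⇔ (InUnion S u ⊎ InUnion S' u)
InUnion-++ {r = r} {r' = r'} {S = S} {S'} {u} = mk⇔ to from
  where
  to : InUnion (S ++ S') u → InUnion S u ⊎ InUnion S' u
  to (i , h) with splitAt r i
  ... | inj₁ j = inj₁ (j , h)
  ... | inj₂ j = inj₂ (j , h)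
  from : InUnion S u ⊎ InUnion S' u → InUnion (S ++ S') u
  from (inj₁ (j , h)) = j ↑ˡ r' , subst (u ∈_) (sym (lookup-++ˡ S S' j)) h
  from (inj₂ (j , h)) = r ↑ʳ j , subst (u ∈_) (sym (lookup-++ʳ S S' j)) h

InUnion-pair : {p p' : Subset a} {u : Fin a} → InUnion (p ∷ (p' ∷ [])) u ⇔ u ∈ p ∪ p'
InUnion-pair {p = p} {p'} = mk⇔ to from
  where
  to : ∀ {u} → InUnion (p ∷ (p' ∷ [])) u → u ∈ p ∪ p'
  to (zero , h)     = x∈p∪q⁺ (inj₁ h)
  to (suc zero , h) = x∈p∪q⁺ (inj₂ h)
  from : ∀ {u} → u ∈ p ∪ p' → InUnion (p ∷ (p' ∷ [])) u
  from h = [ (zero ,_) , (suc zero ,_) ]′ (x∈p∪q⁻ p p' h)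

InUnion-split : {S : Vector (Subset a) r} {p p' s : Subset a} → p ∪ p' ≡ s → ∀ {u} →
                InUnion (S ++ (s ∷ [])) u ⇔ InUnion (S ++ (p ∷ (p' ∷ []))) u
InUnion-split refl = mk⇔
  (Equivalence.from InUnion-++ ∘ Sum.map₂ (Equivalence.from InUnion-pair ∘ λ { (zero , h) → h }) ∘ Equivalence.to InUnion-++)
  (Equivalence.from InUnion-++ ∘ Sum.map₂ ((zero ,_) ∘ Equivalence.to InUnion-pair) ∘ Equivalence.to InUnion-++)

PreservesLabels-⊆ : (G H : EGraph) (R : Rel G H) {S : Vector (Subset (n G)) r} {S' : Vector (Subset (n G)) r'}
                    {f : Fin (n G) → Fin (n H)} → (∀ {u} → InUnion S' u → InUnion S u) →
                    PreservesLabels G H R S f → PreservesLabels G H R S' f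
PreservesLabels-⊆ G H R S'⊆S pres u v hu hv = pres u v (S'⊆S hu) (S'⊆S hv)

PreservesLabels⇒Prec : (G H : EGraph) (R : Rel G H) (P : Partition (n H)) {S : Vector (Subset (n G)) r}
                       {t : Vector (Fin (q P)) r} {f : Fin (n G) → Fin (n H)} →
                       MapsInto S (λ i → Block P (t i)) f → PreservesLabels G H R S f → Prec G H R P S t
PreservesLabels⇒Prec G H R P {f = f} m pres i i' x constant u v hu hv =
  subst (R (lab G u v)) (constant (f u) (f v) (m i u hu) (m i' v hv)) (pres u v (i , hu) (i' , hv))

module _ (G H : EGraph) (R : Rel G H) (P : Partition (n H)) {t : Vector (Fin (q P)) r} {tp tp1 : Fin (q P)}
         {S : Vector (Subset (n G)) r} {S0 : Subset (n G)} {f : Fin (n G) → Fin (n H)} where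

  private
    mapsInto-pair : Subset (n G) × Subset (n G) → Set
    mapsInto-pair (p , p') = MapsInto (p ∷ (p' ∷ [])) (Block P tp ∷ (Block P tp1 ∷ [])) f

    mapsInto-pair-of-InPiece : ∀ {A} → InPiece G H R P t tp tp1 S S0 A f → mapsInto-pair A
    mapsInto-pair-of-InPiece (_ , _ , m , _) = proj₂ (MapsInto-++⁻ m)

  sent-to-tp : Decidable (λ u → Block P tp (f u))
  sent-to-tp u = part P (f u) ≟ tp

  InPiece-of-IsRMor : IsRMor G H R (S ++ (S0 ∷ [])) ((λ i → Block P (t i)) ++ (BlockUnion P tp tp1 ∷ [])) f →
                      InPiece G H R P t tp tp1 S S0 (S0 ∩ toSubset sent-to-tp , S0 ∩ ∁ (toSubset sent-to-tp)) f
  InPiece-of-IsRMor (m , pres) =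
    (split , ∩-∩∁-disjoint S0 _) , PreservesLabels⇒Prec G H R P (MapsInto-resp (Block-++ P t tp tp1) m₂) pres₂ , m₂ , pres₂
    where
    Sp Sp1 : Subset (n G)
    Sp  = S0 ∩ toSubset sent-to-tp
    Sp1 = S0 ∩ ∁ (toSubset sent-to-tp)
    split : Sp ∪ Sp1 ≡ S0
    split = ∩-∪-∩∁ S0 (toSubset sent-to-tp)
    mS : MapsInto S (λ i → Block P (t i)) f
    mS = proj₁ (MapsInto-++⁻ m)
    m₀ : MapsInto (S0 ∷ []) (BlockUnion P tp tp1 ∷ []) f
    m₀ = proj₂ (MapsInto-++⁻ m)
    mPair : mapsInto-pair (Sp , Sp1)
    mPair zero u h = ∈-toSubset⁻ sent-to-tp (proj₂ (x∈p∩q⁻ S0 _ h))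
    mPair (suc zero) u h with x∈p∩q⁻ S0 _ h
    ... | inS0 , not-to-tp with m₀ zero u inS0
    ... | inj₁ to-tp  = contradiction (∈-toSubset⁺ sent-to-tp to-tp) (x∈∁p⇒x∉p not-to-tp)
    ... | inj₂ to-tp1 = to-tp1
    m₂ : MapsInto (S ++ (Sp ∷ (Sp1 ∷ []))) ((λ i → Block P (t i)) ++ (Block P tp ∷ (Block P tp1 ∷ []))) f
    m₂ = MapsInto-++⁺ mS mPair
    pres₂ : PreservesLabels G H R (S ++ (Sp ∷ (Sp1 ∷ []))) f
    pres₂ = PreservesLabels-⊆ G H R (Equivalence.from (InUnion-split {S = S} split)) pres

  IsRMor-of-InPiece : ∀ {A} → InPiece G H R P t tp tp1 S S0 A f →
                      IsRMor G H R (S ++ (S0 ∷ [])) ((λ i → Block P (t i)) ++ (BlockUnion P tp tp1 ∷ [])) f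
  IsRMor-of-InPiece {p , p'} piece@((split , _) , _ , m₂ , pres₂) =
    MapsInto-++⁺ (proj₁ (MapsInto-++⁻ m₂)) m₀ , PreservesLabels-⊆ G H R (Equivalence.to (InUnion-split {S = S} split)) pres₂
    where
    m₀ : MapsInto (S0 ∷ []) (BlockUnion P tp tp1 ∷ []) f
    m₀ zero u h = Sum.map (mPair zero u) (mPair (suc zero) u) (x∈p∪q⁻ p p' (subst (u ∈_) (sym split) h))
      where mPair = mapsInto-pair-of-InPiece piece

  InPiece-unique : tp ≢ tp1 → ∀ {A B} → InPiece G H R P t tp tp1 S S0 A f → InPiece G H R P t tp tp1 S S0 B f → A ≡ B
  InPiece-unique tp≢tp1 {p , p'} {s , s'} pieceA pieceB with
    ∪-split-unique (trans (proj₁ (proj₁ pieceA)) (sym (proj₁ (proj₁ pieceB))))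
      (separated (mapsInto-pair-of-InPiece pieceA) (mapsInto-pair-of-InPiece pieceB))
      (separated (mapsInto-pair-of-InPiece pieceB) (mapsInto-pair-of-InPiece pieceA))
    where
    separated : ∀ {x x' y y'} → mapsInto-pair (x , x') → mapsInto-pair (y , y') → ∀ {u} → u ∈ x → u ∉ y'
    separated mx my {u} h h' = tp≢tp1 (trans (sym (mx zero u h)) (my (suc zero) u h'))
  ... | refl , refl = refl

lemma2 : (G H : EGraph) (R : Rel G H) (P : Partition (n H)) (r : ℕ)
         (t : Vector (Fin (q P)) r) (tp tp1 : Fin (q P))
         (S : Vector (Subset (n G)) r) (S0 : Subset (n G)) →
         Distinct (t ++ (tp ∷ (tp1 ∷ []))) →
         PairwiseDisjoint (S ++ (S0 ∷ [])) →
         (∀ (f : Fin (n G) → Fin (n H)) →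
            IsRMor G H R (S ++ (S0 ∷ []))
              ((λ i → Block P (t i)) ++ (BlockUnion P tp tp1 ∷ [])) f
            ⇔ Σ (Subset (n G) × Subset (n G))
                (λ A → InPiece G H R P t tp tp1 S S0 A f))
         ×
         (∀ (f : Fin (n G) → Fin (n H)) (A B : Subset (n G) × Subset (n G)) →
            InPiece G H R P t tp tp1 S S0 A f →
            InPiece G H R P t tp tp1 S S0 B f →
            A ≡ B)
lemma2 G H R P r t tp tp1 S S0 distinct _ =
  (λ f → mk⇔ (λ mor → _ , InPiece-of-IsRMor G H R P mor) (λ (_ , piece) → IsRMor-of-InPiece G H R P piece)) ,
  (λ f A B → InPiece-unique G H R P (last-two-distinct distinct))
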